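{- Let $S,T$ be normal trees on $2\times\omega$. If $S\ne T$, then the combinatorial trees $G_S$ and $G_T$ are not isomorphic.
   Context: A normal tree on $2\times\omega$ is a set $T$ of pairs $(u,s)$ with $u\in{}^{<\omega}2$, $s\in{}^{<\omega}\omega$, $|u|=|s|$, closed under taking initial segments (of both coordinates simultaneously), such that $(u,s)\in T$ and $s\le t$ pointwise with $|t|=|s|$ imply $(u,t)\in T$. Fix a bijection $\#\colon{}^{<\omega}\omega\to\omega$ and a bijection $\theta\colon{}^{<\omega}2\to\omega$ with $|u|<|v|\Rightarrow\theta(u)<\theta(v)$. Let $G_0$ be the combinatorial tree obtained from the tree ${}^{<\omega}\omega$ by inserting, for each $s\ne\emptyset$, a new vertex $s^*$ between $s\restriction(|s|-1)$ and $s$. Let $G_1$ be obtained from $G_0$ by adding, for each $s\in{}^{<\omega}\omega$, vertices $s^+, s^{++}$ and $(s^{++},i,j)$ for $0\le j\le i\le \#s+2$, with edges $s - s^+$, $s^+ - s^{++}$, $s^{++} - (s^{++},i,0)$ and $(s^{++},i,j) - (s^{++},i,j+1)$ (when defined). For a normal tree $T$, $G_T$ is obtained from $G_1$ by adding, for each $(u,s)\in T$, vertices $(u,s,x)$ where $x$ is an initial segment of $0^{2\theta(u)+4}$ or $x=0^{2\theta(u)+2}{}^\frown 1$, with edges $(u,s,\emptyset) - s$ and $(u,s,x)-(u,s,x')$ whenever one of $x,x'$ is an immediate successor of the other. -}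

module Defs where

open import Data.Nat using (ℕ; zero; suc; _+_; _*_; _≤_; _<_)
open import Data.Bool using (Bool; true; false)
open import Data.Unit using (⊤)
open import Data.List using (List; []; _∷_; _∷ʳ_; length; take; replicate)
open import Data.List.Relation.Binary.Pointwise using (Pointwise)
open import Data.Product using (Σ; _×_; _,_; proj₁)
open import Data.Sum using (_⊎_)
open import Relation.Binary.PropositionalEquality using (_≡_)
open import Relation.Nullary using (¬_)
open import Function.Bundles using (_⤖_; Bijection; _⇔_)

-- finite binary sequences u ∈ ^{<ω}2 (false = 0, true = 1) and
-- finite sequences s ∈ ^{<ω}ω
Seq2 : Set
Seq2 = List Bool

Seqω : Set
Seqω = List ℕ

record NormalTree : Set₁ where
  field
    mem      : Seq2 → Seqω → Set
    mem-prop : ∀ {u s} (p q : mem u s) → p ≡ q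
    mem-len  : ∀ {u s} → mem u s → length u ≡ length s
    mem-init : ∀ {u s} (n : ℕ) → mem u s → mem (take n u) (take n s)
    mem-up   : ∀ {u s t} → mem u s → Pointwise _≤_ s t → mem u t

open NormalTree public

SameSet : NormalTree → NormalTree → Set
SameSet S T = ∀ u s → (mem S u s → mem T u s) × (mem T u s → mem S u s)

record Graph : Set₁ where
  field
    V : Set
    E : V → V → Set

record Iso (G H : Graph) : Set where
  field
    bij  : Graph.V G ⤖ Graph.V H
    edge : ∀ a b → Graph.E G a b ⇔ Graph.E H (Bijection.to bij a) (Bijection.to bij b)

data RawV : Set where
  node  : Seqω → RawV
  star  : Seqω → ℕ → RawV           -- (s ⌢ n)*
  plus  : Seqω → RawV               -- s⁺
  plus2 : Seqω → RawV               -- s⁺⁺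
  leg   : Seqω → ℕ → ℕ → RawV       -- (s⁺⁺ , i , j)
  tv    : Seq2 → Seqω → Seq2 → RawV -- (u , s , x)

data TailOK (m : ℕ) : Seq2 → Set where
  zeros    : ∀ k → k ≤ 2 * m + 4 → TailOK m (replicate k false)
  zerosOne : TailOK m (replicate (2 * m + 2) false ∷ʳ true)

-- directed version of the edges (the graph is the symmetric closure)
data Adj : RawV → RawV → Set where
  node-star  : ∀ s n → Adj (node s) (star s n)
  star-node  : ∀ s n → Adj (star s n) (node (s ∷ʳ n))
  node-plus  : ∀ s → Adj (node s) (plus s)
  plus-plus2 : ∀ s → Adj (plus s) (plus2 s)
  plus2-leg  : ∀ s i → Adj (plus2 s) (leg s i 0)
  leg-leg    : ∀ s i j → Adj (leg s i j) (leg s i (suc j))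
  node-tv    : ∀ u s → Adj (node s) (tv u s [])
  tv-tv      : ∀ u s x b → Adj (tv u s x) (tv u s (x ∷ʳ b))

module _ (hash : Seqω → ℕ) (θ : Seq2 → ℕ) where

  InG : NormalTree → RawV → Set
  InG T (node s)    = ⊤
  InG T (star s n)  = ⊤
  InG T (plus s)    = ⊤
  InG T (plus2 s)   = ⊤
  InG T (leg s i j) = j ≤ i × i ≤ hash s + 2
  InG T (tv u s x)  = mem T u s × TailOK (θ u) x

  G : NormalTree → Graph
  G T = record
    { V = Σ RawV (InG T)
    ; E = λ a b → Adj (proj₁ a) (proj₁ b) ⊎ Adj (proj₁ b) (proj₁ a)
    }

G[_,_]_ : (Seqω ⤖ ℕ) → (Seq2 ⤖ ℕ) → NormalTree → Graph
G[ h , t ] T = G (Bijection.to h) (Bijection.to t) T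

module Submission where

-- Fix (u, s) ∈ S.  In G_S the vertex (u, s, ∅) is singled out by
-- shapes that isomorphisms preserve: s⁺⁺ is the unique vertex ("hub") carrying
-- a pendant leaf and a pendant path with # s + 3 vertices but none longer; s is
-- then the unique branching vertex at distance two from it ("anchor"); and
-- (u, s, ∅) is the unique vertex from which a path of 2θ(u) + 2 vertices of
-- degree two leads from s to a fork (a vertex with a pendant leaf and a pendant
-- path of two vertices), namely the branch point 0^{2θ(u)+2} of the gadget at
-- (u, s).  An isomorphism G_S ≅ G_T maps this "marker" to a marker with the same
-- parameters in G_T, which must be (u, s, ∅); hence (u, s) ∈ T.  By symmetry
-- S = T.

open import Defs
open import Data.Nat using (ℕ; zero; suc; _+_; _*_; _≤_; _<_; z≤n; s≤s; _≟_)
open import Data.Nat.Properties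
open import Data.Bool using (Bool; true; false)
import Data.Bool as Bool
open import Data.Unit using (tt)
open import Data.List using (List; []; _∷_; _∷ʳ_; length; replicate)
open import Data.List.Properties using (∷ʳ-injective; length-replicate; ≡-dec)
open import Data.Product using (Σ; _×_; _,_; proj₁; proj₂)
open import Data.Sum using (_⊎_; inj₁; inj₂)
import Data.Sum as Sum
open import Data.Empty using (⊥; ⊥-elim)
open import Function.Base using (_∘_)
open import Relation.Binary.PropositionalEquality
open import Relation.Nullary using (¬_; yes; no)
open import Function.Bundles using (_⤖_; Bijection; Inverse; Equivalence)
open import Function.Properties.Bijection using (⤖⇒↔)
open import Axiom.UniquenessOfIdentityProofs using (module Decidable⇒UIP)

module _ {A : Set} where

  In₂ : A → A → A → Set
  In₂ w a b = w ≡ a ⊎ w ≡ b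

  In₃ : A → A → A → A → Set
  In₃ w a b c = w ≡ a ⊎ In₂ w b c

  AllDistinct₄ : A → A → A → A → Set
  AllDistinct₄ x₁ x₂ x₃ x₄ =
    (x₁ ≢ x₂) × (x₁ ≢ x₃) × (x₁ ≢ x₄) × (x₂ ≢ x₃) × (x₂ ≢ x₄) × (x₃ ≢ x₄)

  three-into-two : ∀ {x y z a b} → x ≢ y → y ≢ z → x ≢ z →
                   In₂ x a b → In₂ y a b → In₂ z a b → ⊥
  three-into-two x≢y _ _ (inj₁ x≡) (inj₁ y≡) _ = x≢y (trans x≡ (sym y≡))
  three-into-two x≢y _ _ (inj₂ x≡) (inj₂ y≡) _ = x≢y (trans x≡ (sym y≡))
  three-into-two _ _ x≢z (inj₁ x≡) (inj₂ _) (inj₁ z≡) = x≢z (trans x≡ (sym z≡))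
  three-into-two _ y≢z _ (inj₁ _) (inj₂ y≡) (inj₂ z≡) = y≢z (trans y≡ (sym z≡))
  three-into-two _ y≢z _ (inj₂ _) (inj₁ y≡) (inj₁ z≡) = y≢z (trans y≡ (sym z≡))
  three-into-two _ _ x≢z (inj₂ x≡) (inj₁ _) (inj₂ z≡) = x≢z (trans x≡ (sym z≡))

  -- Four distinct elements do not fit into three places: whichever place x₁
  -- occupies, the other three elements must share the remaining two.
  four-into-three : ∀ {x₁ x₂ x₃ x₄ a b c} → AllDistinct₄ x₁ x₂ x₃ x₄ →
                    In₃ x₁ a b c → In₃ x₂ a b c → In₃ x₃ a b c → In₃ x₄ a b c → ⊥
  four-into-three {x₁} {a = a} {b} {c} (d₁₂ , d₁₃ , d₁₄ , d₂₃ , d₂₄ , d₃₄)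
                  (inj₁ x₁≡a) i₂ i₃ i₄ =
    three-into-two d₂₃ d₃₄ d₂₄ (avoid i₂ d₁₂) (avoid i₃ d₁₃) (avoid i₄ d₁₄)
    where
      avoid : ∀ {y} → In₃ y a b c → x₁ ≢ y → In₂ y b c
      avoid (inj₁ y≡a) x₁≢y = ⊥-elim (x₁≢y (trans x₁≡a (sym y≡a)))
      avoid (inj₂ y∈) _ = y∈
  four-into-three {x₁} {a = a} {b} {c} (d₁₂ , d₁₃ , d₁₄ , d₂₃ , d₂₄ , d₃₄)
                  (inj₂ (inj₁ x₁≡b)) i₂ i₃ i₄ =
    three-into-two d₂₃ d₃₄ d₂₄ (avoid i₂ d₁₂) (avoid i₃ d₁₃) (avoid i₄ d₁₄)
    where
      avoid : ∀ {y} → In₃ y a b c → x₁ ≢ y → In₂ y a c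
      avoid (inj₁ y≡a) _ = inj₁ y≡a
      avoid (inj₂ (inj₁ y≡b)) x₁≢y = ⊥-elim (x₁≢y (trans x₁≡b (sym y≡b)))
      avoid (inj₂ (inj₂ y≡c)) _ = inj₂ y≡c
  four-into-three {x₁} {a = a} {b} {c} (d₁₂ , d₁₃ , d₁₄ , d₂₃ , d₂₄ , d₃₄)
                  (inj₂ (inj₂ x₁≡c)) i₂ i₃ i₄ =
    three-into-two d₂₃ d₃₄ d₂₄ (avoid i₂ d₁₂) (avoid i₃ d₁₃) (avoid i₄ d₁₄)
    where
      avoid : ∀ {y} → In₃ y a b c → x₁ ≢ y → In₂ y a b
      avoid (inj₁ y≡a) _ = inj₁ y≡a
      avoid (inj₂ (inj₁ y≡b)) _ = inj₂ y≡b
      avoid (inj₂ (inj₂ y≡c)) x₁≢y = ⊥-elim (x₁≢y (trans x₁≡c (sym y≡c)))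

-- A pendant path
-- hanging from p through q is a path q = x₀ - x₁ - … - xₙ whose inner vertices
-- have degree two and whose last vertex is a leaf; everything below is built
-- from such paths, so it is preserved by isomorphisms.
module Shapes (Γ : Graph) where
  open Graph Γ

  -- Hanging n p q: q is adjacent to p and starts a pendant path with n + 1
  -- vertices pointing away from p.
  Hanging : ℕ → V → V → Set
  Hanging zero    p q = E p q × (∀ w → E q w → w ≡ p)
  Hanging (suc n) p q = E p q × Σ V λ w → (w ≢ p) × Hanging n q w × (∀ w′ → E q w′ → In₂ w′ p w)

  Fork : V → V → Set
  Fork p v = E p v × Σ V λ w₁ → Σ V λ w₂ → (w₁ ≢ p) × (w₂ ≢ p) ×
             Hanging 0 v w₁ × Hanging 1 v w₂ × (∀ w → E v w → In₃ w p w₁ w₂)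

  Chain : ℕ → V → V → Set
  Chain zero    p v = Fork p v
  Chain (suc k) p v = E p v × Σ V λ w → (w ≢ p) × Chain k v w × (∀ w′ → E v w′ → In₂ w′ p w)

  Hub : ℕ → V → Set
  Hub n b = (Σ V λ q → Hanging 0 b q) × (Σ V λ q → Hanging n b q) ×
            (∀ q → E b q → ¬ Hanging (suc n) b q)

  Branching : V → Set
  Branching p = Σ V λ x → Σ V λ y → Σ V λ z →
                E p x × E p y × E p z × (x ≢ y) × (y ≢ z) × (x ≢ z)

  Anchor : ℕ → V → Set
  Anchor n p = Σ V λ a → Σ V λ b → Hub n b × E b a × E a p × (p ≢ b) × Branching p

  Marker : ℕ → ℕ → V → Set
  Marker n k v = Σ V λ p → Anchor n p × Chain k p v

  Crowded : V → Set
  Crowded r = Σ V λ x₁ → Σ V λ x₂ → Σ V λ x₃ → Σ V λ x₄ →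
              E r x₁ × E r x₂ × E r x₃ × E r x₄ × AllDistinct₄ x₁ x₂ x₃ x₄

  hanging-edge : ∀ n {p q} → Hanging n p q → E p q
  hanging-edge zero    = proj₁
  hanging-edge (suc n) = proj₁

  chain-edge : ∀ k {p v} → Chain k p v → E p v
  chain-edge zero    = proj₁
  chain-edge (suc k) = proj₁

  crowded-not-In₃ : ∀ {r a b c} → Crowded r → ¬ (∀ w → E r w → In₃ w a b c)
  crowded-not-In₃ (_ , _ , _ , _ , e₁ , e₂ , e₃ , e₄ , d) nbrs =
    four-into-three d (nbrs _ e₁) (nbrs _ e₂) (nbrs _ e₃) (nbrs _ e₄)

  private
    In₂⇒In₃ : ∀ {w a b : V} → In₂ w a b → In₃ w a b b
    In₂⇒In₃ (inj₁ w≡a) = inj₁ w≡a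
    In₂⇒In₃ (inj₂ w≡b) = inj₂ (inj₁ w≡b)

  hanging-not-crowded : ∀ n {p r} → Hanging n p r → ¬ Crowded r
  hanging-not-crowded zero {p} (_ , nbrs) c = crowded-not-In₃ {a = p} {p} {p} c (λ w e → inj₁ (nbrs w e))
  hanging-not-crowded (suc n) (_ , _ , _ , _ , nbrs) c = crowded-not-In₃ c (λ w e → In₂⇒In₃ (nbrs w e))

  chain-not-crowded : ∀ k {p r} → Chain k p r → ¬ Crowded r
  chain-not-crowded zero    (_ , _ , _ , _ , _ , _ , _ , nbrs) c = crowded-not-In₃ c nbrs
  chain-not-crowded (suc k) (_ , _ , _ , _ , nbrs) c = crowded-not-In₃ c (λ w e → In₂⇒In₃ (nbrs w e))

  leaf-not-long : ∀ {b q} → Hanging 0 b q → ∀ n → ¬ Hanging (suc n) b q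
  leaf-not-long (_ , nbrs) n (_ , w , w≢b , w-path , _) = w≢b (nbrs w (hanging-edge n w-path))

-- A graph isomorphism with an explicit inverse; unlike Iso this is
-- visibly symmetric.
record GraphIso (Γ Δ : Graph) : Set where
  field
    to        : Graph.V Γ → Graph.V Δ
    from      : Graph.V Δ → Graph.V Γ
    from-to   : ∀ x → from (to x) ≡ x
    to-from   : ∀ y → to (from y) ≡ y
    to-edge   : ∀ {a b} → Graph.E Γ a b → Graph.E Δ (to a) (to b)
    from-edge : ∀ {a b} → Graph.E Δ a b → Graph.E Γ (from a) (from b)

iso-sym : ∀ {Γ Δ} → GraphIso Γ Δ → GraphIso Δ Γ
iso-sym φ = record
  { to = from ; from = to ; from-to = to-from ; to-from = from-to
  ; to-edge = from-edge ; from-edge = to-edge }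
  where open GraphIso φ

toGraphIso : ∀ {Γ Δ} → Iso Γ Δ → GraphIso Γ Δ
toGraphIso {Γ} {Δ} iso = record
  { to = to ; from = from
  ; from-to = strictlyInverseʳ ; to-from = strictlyInverseˡ
  ; to-edge = λ {a} {b} → Equivalence.to (Iso.edge iso a b)
  ; from-edge = λ {a} {b} e → Equivalence.from (Iso.edge iso (from a) (from b))
                  (subst₂ (Graph.E Δ) (sym (strictlyInverseˡ a)) (sym (strictlyInverseˡ b)) e)
  }
  where open Inverse (⤖⇒↔ (Iso.bij iso))

module Transport {Γ Δ : Graph} (φ : GraphIso Γ Δ) where
  open GraphIso φ
  private
    module A = Shapes Γ
    module B = Shapes Δ

  to-≢ : ∀ {a b} → a ≢ b → to a ≢ to b
  to-≢ {a} {b} a≢b to-a≡to-b = a≢b (begin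
    a           ≡⟨ sym (from-to a) ⟩
    from (to a) ≡⟨ cong from to-a≡to-b ⟩
    from (to b) ≡⟨ from-to b ⟩
    b           ∎)
    where open ≡-Reasoning

  pull-edge : ∀ {a w} → Graph.E Δ (to a) w → Graph.E Γ a (from w)
  pull-edge {a} e = subst (λ x → Graph.E Γ x _) (from-to a) (from-edge e)

  push-≡ : ∀ {w a} → from w ≡ a → w ≡ to a
  push-≡ {w} from-w≡a = trans (sym (to-from w)) (cong to from-w≡a)

  hanging : ∀ n {p q} → A.Hanging n p q → B.Hanging n (to p) (to q)
  hanging zero    (e , nbrs) = to-edge e , λ w e′ → push-≡ (nbrs (from w) (pull-edge e′))
  hanging (suc n) (e , w , w≢p , w-path , nbrs) =
    to-edge e , to w , to-≢ w≢p , hanging n w-path ,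
    λ w′ e′ → Sum.map push-≡ push-≡ (nbrs (from w′) (pull-edge e′))

  fork : ∀ {p v} → A.Fork p v → B.Fork (to p) (to v)
  fork (e , w₁ , w₂ , w₁≢p , w₂≢p , leaf , path , nbrs) =
    to-edge e , to w₁ , to w₂ , to-≢ w₁≢p , to-≢ w₂≢p , hanging 0 leaf , hanging 1 path ,
    λ w e′ → Sum.map push-≡ (Sum.map push-≡ push-≡) (nbrs (from w) (pull-edge e′))

  chain : ∀ k {p v} → A.Chain k p v → B.Chain k (to p) (to v)
  chain zero    c = fork c
  chain (suc k) (e , w , w≢p , rest , nbrs) =
    to-edge e , to w , to-≢ w≢p , chain k rest ,
    λ w′ e′ → Sum.map push-≡ push-≡ (nbrs (from w′) (pull-edge e′))

  branching : ∀ {p} → A.Branching p → B.Branching (to p)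
  branching (x , y , z , ex , ey , ez , x≢y , y≢z , x≢z) =
    to x , to y , to z , to-edge ex , to-edge ey , to-edge ez , to-≢ x≢y , to-≢ y≢z , to-≢ x≢z

-- The negative clause of a hub is transported backwards along the inverse.
transport-hub : ∀ {Γ Δ} (φ : GraphIso Γ Δ) n {b} → Shapes.Hub Γ n b → Shapes.Hub Δ n (GraphIso.to φ b)
transport-hub {Γ} φ n {b} ((q₀ , leaf) , (qₙ , path) , no-longer) =
  (to q₀ , hanging 0 leaf) , (to qₙ , hanging n path) ,
  λ q e longer → no-longer (from q) (pull-edge e)
    (subst (λ x → Shapes.Hanging Γ (suc n) x (from q)) (from-to b)
           (Transport.hanging (iso-sym φ) (suc n) longer))
  where open GraphIso φ
        open Transport φ

transport-marker : ∀ {Γ Δ} (φ : GraphIso Γ Δ) n k {v} →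
                   Shapes.Marker Γ n k v → Shapes.Marker Δ n k (GraphIso.to φ v)
transport-marker φ n k (p , (a , b , hub , eba , eap , p≢b , br) , c) =
  to p , (to a , to b , transport-hub φ n hub , to-edge eba , to-edge eap , to-≢ p≢b , branching br) ,
  chain k c
  where open GraphIso φ
        open Transport φ

n≢2+n : ∀ n → n ≢ suc (suc n)
n≢2+n n = m≢1+n+m n {1}

length-∷ʳ : ∀ {A : Set} (xs : List A) x → length (xs ∷ʳ x) ≡ suc (length xs)
length-∷ʳ []       x = refl
length-∷ʳ (_ ∷ xs) x = cong suc (length-∷ʳ xs x)

∷ʳ≢[] : ∀ {A : Set} (xs : List A) x → xs ∷ʳ x ≢ []
∷ʳ≢[] []      _ ()
∷ʳ≢[] (_ ∷ _) _ ()

∷ʳ-≢ : ∀ {A : Set} (xs : List A) x → xs ≢ xs ∷ʳ x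
∷ʳ-≢ xs x xs≡ = 1+n≢n (sym (trans (cong length xs≡) (length-∷ʳ xs x)))

zeroes : ℕ → Seq2
zeroes k = replicate k false

zeroes-suc : ∀ k → zeroes (suc k) ≡ zeroes k ∷ʳ false
zeroes-suc zero    = refl
zeroes-suc (suc k) = cong (false ∷_) (zeroes-suc k)

zeroes-injective : ∀ {a b} → zeroes a ≡ zeroes b → a ≡ b
zeroes-injective {a} {b} eq = trans (sym (length-replicate a)) (trans (cong length eq) (length-replicate b))

zeroes≢flagged : ∀ a y → zeroes a ≢ y ∷ʳ true
zeroes≢flagged zero    []      ()
zeroes≢flagged zero    (_ ∷ _) ()
zeroes≢flagged (suc a) y eq with () ← proj₂ (∷ʳ-injective (zeroes a) y (trans (sym (zeroes-suc a)) eq))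

tailOK-view : ∀ {m x} → TailOK m x →
              (Σ ℕ λ k → x ≡ zeroes k × k ≤ 2 * m + 4) ⊎ x ≡ zeroes (2 * m + 2) ∷ʳ true
tailOK-view (zeros k k≤) = inj₁ (k , refl , k≤)
tailOK-view zerosOne     = inj₂ refl

tailOK-bound : ∀ {m x k} → TailOK m x → x ≡ zeroes k → k ≤ 2 * m + 4
tailOK-bound tok x≡ with tailOK-view tok
... | inj₁ (k′ , x≡′ , k′≤) = subst (_≤ _) (zeroes-injective (trans (sym x≡′) x≡)) k′≤
... | inj₂ x≡flag = ⊥-elim (zeroes≢flagged _ _ (trans (sym x≡) x≡flag))

-- Proofs of TailOK are unique (Seq2 has decidable equality, hence UIP).
TailOK-irrelevant : ∀ {m x} (a b : TailOK m x) → a ≡ b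
TailOK-irrelevant a b = along a b refl
  where
    uip : ∀ {x y : Seq2} (p q : x ≡ y) → p ≡ q
    uip = Decidable⇒UIP.≡-irrelevant (≡-dec Bool._≟_)
    along : ∀ {m x y} (a : TailOK m x) (b : TailOK m y) (e : x ≡ y) → subst (TailOK m) e a ≡ b
    along (zeros k p) (zeros k′ q) e with refl ← zeroes-injective e rewrite uip e refl =
      cong (zeros k) (≤-irrelevant p q)
    along (zeros k p) zerosOne     e = ⊥-elim (zeroes≢flagged k _ e)
    along zerosOne    (zeros k q)  e = ⊥-elim (zeroes≢flagged k _ (sym e))
    along zerosOne    zerosOne     e rewrite uip e refl = refl

allowed-prefix : ∀ {m y b} → TailOK m (y ∷ʳ b) → Σ ℕ λ k → y ≡ zeroes k
allowed-prefix {y = y} {b} tok with tailOK-view tok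
... | inj₁ (zero , y∷b≡ , _) = ⊥-elim (∷ʳ≢[] y b y∷b≡)
... | inj₁ (suc k , y∷b≡ , _) = k , proj₁ (∷ʳ-injective y (zeroes k) (trans y∷b≡ (zeroes-suc k)))
... | inj₂ y∷b≡ = _ , proj₁ (∷ʳ-injective y _ y∷b≡)

allowed-extension : ∀ {m k b} → TailOK m (zeroes k ∷ʳ b) → b ≡ false ⊎ (b ≡ true × k ≡ 2 * m + 2)
allowed-extension {k = k} {b} tok with tailOK-view tok
... | inj₁ (zero , e , _) = ⊥-elim (∷ʳ≢[] (zeroes k) b e)
... | inj₁ (suc k′ , e , _) = inj₁ (proj₂ (∷ʳ-injective (zeroes k) (zeroes k′) (trans e (zeroes-suc k′))))
... | inj₂ e with ∷ʳ-injective (zeroes k) _ e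
...   | k-zeroes , b≡ = inj₂ (b≡ , zeroes-injective k-zeroes)

word : RawV → Seq2
word (tv _ _ x) = x
word _          = []

Adj± : RawV → RawV → Set
Adj± x y = Adj x y ⊎ Adj y x

node-nbrs : ∀ {t r} → Adj± (node t) r →
            (Σ Seqω λ t′ → Σ ℕ λ n → r ≡ star t′ n) ⊎ r ≡ plus t ⊎ (Σ Seq2 λ u → r ≡ tv u t [])
node-nbrs (inj₁ (node-star s n)) = inj₁ (s , n , refl)
node-nbrs (inj₂ (star-node s n)) = inj₁ (s , n , refl)
node-nbrs (inj₁ (node-plus s))   = inj₂ (inj₁ refl)
node-nbrs (inj₁ (node-tv u s))   = inj₂ (inj₂ (u , refl))

star-nbrs : ∀ {t n r} → Adj± (star t n) r → In₂ r (node t) (node (t ∷ʳ n))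
star-nbrs (inj₁ (star-node s n)) = inj₂ refl
star-nbrs (inj₂ (node-star s n)) = inj₁ refl

plus-nbrs : ∀ {t r} → Adj± (plus t) r → In₂ r (node t) (plus2 t)
plus-nbrs (inj₁ (plus-plus2 s)) = inj₂ refl
plus-nbrs (inj₂ (node-plus s))  = inj₁ refl

plus2-nbrs : ∀ {t r} → Adj± (plus2 t) r → r ≡ plus t ⊎ Σ ℕ λ i → r ≡ leg t i 0
plus2-nbrs (inj₁ (plus2-leg s i)) = inj₂ (i , refl)
plus2-nbrs (inj₂ (plus-plus2 s))  = inj₁ refl

leg-pred : Seqω → ℕ → ℕ → RawV
leg-pred t i zero    = plus2 t
leg-pred t i (suc j) = leg t i j

LegPred : Seqω → ℕ → ℕ → RawV → Set
LegPred t i j r = r ≡ leg-pred t i j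

legPred-unique : ∀ {t i} j {r r′} → LegPred t i j r → LegPred t i j r′ → r ≡ r′
legPred-unique _ r≡ r′≡ = trans r≡ (sym r′≡)

legPred-≢-next : ∀ {t i} j {r} → LegPred t i j r → r ≢ leg t i (suc j)
legPred-≢-next zero    refl ()
legPred-≢-next (suc j) refl ()

leg-nbrs : ∀ {t i j r} → Adj± (leg t i j) r → r ≡ leg t i (suc j) ⊎ LegPred t i j r
leg-nbrs (inj₁ (leg-leg s i j)) = inj₁ refl
leg-nbrs (inj₂ (plus2-leg s i)) = inj₂ refl
leg-nbrs (inj₂ (leg-leg s i j)) = inj₂ refl

leg-nbrs⁻ : ∀ {r t i j} → Adj± r (leg t i j) → r ≡ plus2 t ⊎ Σ ℕ λ j′ → r ≡ leg t i j′
leg-nbrs⁻ (inj₁ (plus2-leg s i)) = inj₁ refl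
leg-nbrs⁻ (inj₁ (leg-leg s i j)) = inj₂ (j , refl)
leg-nbrs⁻ (inj₂ (leg-leg s i j)) = inj₂ (suc j , refl)

tv-nbrs : ∀ {u t x r} → Adj± (tv u t x) r →
          (Σ Bool λ b → r ≡ tv u t (x ∷ʳ b)) ⊎ (x ≡ [] × r ≡ node t) ⊎
          (Σ Seq2 λ y → Σ Bool λ b → x ≡ y ∷ʳ b × r ≡ tv u t y)
tv-nbrs (inj₁ (tv-tv u s x b)) = inj₁ (b , refl)
tv-nbrs (inj₂ (node-tv u s))   = inj₂ (inj₁ (refl , refl))
tv-nbrs (inj₂ (tv-tv u s x b)) = inj₂ (inj₂ (x , b , refl , refl))

tail-pred : Seq2 → Seqω → ℕ → RawV
tail-pred u t zero    = node t
tail-pred u t (suc k) = tv u t (zeroes k)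

TailPred : Seq2 → Seqω → ℕ → RawV → Set
TailPred u t k r = r ≡ tail-pred u t k

tailPred-unique : ∀ {u t} k {r r′} → TailPred u t k r → TailPred u t k r′ → r ≡ r′
tailPred-unique _ r≡ r′≡ = trans r≡ (sym r′≡)

module Analysis (# : Seqω → ℕ) (θ : Seq2 → ℕ)
                (#-injective : ∀ {s t} → # s ≡ # t → s ≡ t)
                (θ-injective : ∀ {u v} → θ u ≡ θ v → u ≡ v)
                (T : NormalTree) where

  Γ : Graph
  Γ = G # θ T

  open Graph Γ
  open Shapes Γ

  edge-sym : ∀ {a b : V} → E a b → E b a
  edge-sym = Sum.swap

  vertex-≡ : ∀ {x y : V} → proj₁ x ≡ proj₁ y → x ≡ y
  vertex-≡ {r , a} {.r , b} refl = cong (r ,_) (membership-irrelevant r a b)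
    where
      membership-irrelevant : ∀ r (a b : InG # θ T r) → a ≡ b
      membership-irrelevant (node _)    _ _ = refl
      membership-irrelevant (star _ _)  _ _ = refl
      membership-irrelevant (plus _)    _ _ = refl
      membership-irrelevant (plus2 _)   _ _ = refl
      membership-irrelevant (leg _ _ _) (a₁ , a₂) (b₁ , b₂) =
        cong₂ _,_ (≤-irrelevant a₁ b₁) (≤-irrelevant a₂ b₂)
      membership-irrelevant (tv _ _ _)  (a₁ , a₂) (b₁ , b₂) =
        cong₂ _,_ (mem-prop T a₁ b₁) (TailOK-irrelevant a₂ b₂)

  data Heavy : RawV → Set where
    node  : ∀ t → Heavy (node t)
    plus2 : ∀ t → Heavy (plus2 t)

  heavy-crowded : ∀ {w : V} {r} → proj₁ w ≡ r → Heavy r → Crowded w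
  heavy-crowded {_ , _} refl (node t) =
    (star t 0 , tt) , (star t 1 , tt) , (star t 2 , tt) , (star t 3 , tt) ,
    inj₁ (node-star t 0) , inj₁ (node-star t 1) , inj₁ (node-star t 2) , inj₁ (node-star t 3) ,
    (λ ()) , (λ ()) , (λ ()) , (λ ()) , (λ ()) , (λ ())
  heavy-crowded {_ , _} refl (plus2 t) =
    (plus t , tt) , (leg t 0 0 , z≤n , z≤n) , (leg t 1 0 , z≤n , ≤-trans (s≤s z≤n) 2≤#t+2) ,
    (leg t 2 0 , z≤n , 2≤#t+2) ,
    inj₂ (plus-plus2 t) , inj₁ (plus2-leg t 0) , inj₁ (plus2-leg t 1) , inj₁ (plus2-leg t 2) ,
    (λ ()) , (λ ()) , (λ ()) , (λ ()) , (λ ()) , (λ ())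
    where
      2≤#t+2 : 2 ≤ # t + 2
      2≤#t+2 = m≤n+m 2 (# t)

  HeavyNbrs : V → Set
  HeavyNbrs v = ∀ w → E v w → Heavy (proj₁ w)

  heavyNbrs-not-hanging : ∀ d {p v} → HeavyNbrs v → ¬ Hanging (suc d) p v
  heavyNbrs-not-hanging d {v = v} heavy (_ , w , _ , w-path , _) =
    hanging-not-crowded d {v} {w} w-path (heavy-crowded {w} refl (heavy w (hanging-edge d {v} {w} w-path)))

  heavyNbrs-not-chain : ∀ k {p v} → HeavyNbrs v → ¬ Chain k p v
  heavyNbrs-not-chain zero    {v = v} heavy (_ , w₁ , _ , _ , _ , leaf , _) =
    hanging-not-crowded 0 {v} {w₁} leaf (heavy-crowded {w₁} refl (heavy w₁ (hanging-edge 0 {v} {w₁} leaf)))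
  heavyNbrs-not-chain (suc k) {v = v} heavy (_ , w , _ , rest , _) =
    chain-not-crowded k {v} {w} rest (heavy-crowded {w} refl (heavy w (chain-edge k {v} {w} rest)))

  star-heavyNbrs : ∀ {t n q} → HeavyNbrs (star t n , q)
  star-heavyNbrs {t} (_ , _) e with star-nbrs e
  ... | inj₁ refl = node t
  ... | inj₂ refl = node _

  plus-heavyNbrs : ∀ {t q} → HeavyNbrs (plus t , q)
  plus-heavyNbrs {t} (_ , _) e with plus-nbrs e
  ... | inj₁ refl = node t
  ... | inj₂ refl = plus2 t

  star-not-hanging : ∀ d {p : V} {t n q} → ¬ Hanging d p (star t n , q)
  star-not-hanging zero {t = t} {n} (_ , nbrs) =
    ∷ʳ-≢ t n (node-injective (cong proj₁ (trans (nbrs (node t , tt) (inj₂ (node-star t n)))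
                                                (sym (nbrs (node (t ∷ʳ n) , tt) (inj₁ (star-node t n)))))))
    where
      node-injective : ∀ {s t} → node s ≡ node t → s ≡ t
      node-injective refl = refl
  star-not-hanging (suc d) {p} {t} {n} {q} = heavyNbrs-not-hanging d {p} {star t n , q} star-heavyNbrs

  plus-not-hanging : ∀ d {p : V} {t q} → ¬ Hanging d p (plus t , q)
  plus-not-hanging zero {t = t} (_ , nbrs)
    with () ← cong proj₁ (trans (nbrs (node t , tt) (inj₂ (node-plus t)))
                                (sym (nbrs (plus2 t , tt) (inj₁ (plus-plus2 t)))))
  plus-not-hanging (suc d) {p} {t} {q} = heavyNbrs-not-hanging d {p} {plus t , q} plus-heavyNbrs

  leg-not-hanging-backwards : ∀ j d {t i q} {p : V} → proj₁ p ≡ leg t i (suc j) →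
                              ¬ Hanging d p (leg t i j , q)
  leg-not-hanging-backwards zero zero {t} {i} p≡ (_ , nbrs)
    with () ← trans (cong proj₁ (nbrs (plus2 t , tt) (inj₂ (plus2-leg t i)))) p≡
  leg-not-hanging-backwards (suc j) zero {t} {i} {j<i , i≤} p≡ (_ , nbrs)
    with () ← trans (cong proj₁ (nbrs (leg t i j , ≤-trans (n≤1+n j) j<i , i≤) (inj₂ (leg-leg t i j)))) p≡
  leg-not-hanging-backwards j (suc d) {t} {i} {q} p≡ (_ , (r , qr) , w≢p , w-path , _)
    with leg-nbrs (hanging-edge d {leg t i j , q} {r , qr} w-path)
  ... | inj₁ r≡ = w≢p (vertex-≡ (trans r≡ (sym p≡)))
  leg-not-hanging-backwards zero    (suc d) {t} {i} {q} p≡ (_ , (r , qr) , _ , w-path , _) | inj₂ r≡ =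
    hanging-not-crowded d {leg t i 0 , q} {r , qr} w-path (heavy-crowded {r , qr} r≡ (plus2 t))
  leg-not-hanging-backwards (suc j) (suc d) {t} {i} {q} p≡ (_ , (r , qr) , _ , w-path , _) | inj₂ refl =
    leg-not-hanging-backwards j d {t} {i} {qr} {leg t i (suc j) , q} refl w-path

  leg-hanging-length : ∀ d {t i j q} {p : V} → LegPred t i j (proj₁ p) →
                       Hanging d p (leg t i j , q) → d + j ≡ i
  leg-hanging-length zero {t} {i} {j} {j≤i , i≤} p-pred (_ , nbrs) with m≤n⇒m<n∨m≡n j≤i
  ... | inj₂ j≡i = j≡i
  ... | inj₁ j<i = ⊥-elim (legPred-≢-next j p-pred
                     (sym (cong proj₁ (nbrs (leg t i (suc j) , j<i , i≤) (inj₁ (leg-leg t i j))))))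
  leg-hanging-length (suc d) {t} {i} {j} {q} p-pred (_ , (r , qr) , w≢p , w-path , _)
    with leg-nbrs (hanging-edge d {leg t i j , q} {r , qr} w-path)
  ... | inj₁ refl = trans (sym (+-suc d j)) (leg-hanging-length d refl w-path)
  ... | inj₂ r-pred = ⊥-elim (w≢p (vertex-≡ (legPred-unique j r-pred p-pred)))

  leg-hanging : ∀ d j {t i} → d + j ≡ i → (q : InG # θ T (leg t i j)) → (p : V) →
                LegPred t i j (proj₁ p) → E p (leg t i j , q) → Hanging d p (leg t i j , q)
  leg-hanging zero j {t} {i} j≡i q p p-pred e = e , nbrs
    where
      nbrs : ∀ w → E (leg t i j , q) w → w ≡ p
      nbrs (r , qr) e′ with leg-nbrs e′
      ... | inj₁ refl = ⊥-elim (<-irrefl j≡i (proj₁ qr))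
      ... | inj₂ r-pred = vertex-≡ (legPred-unique j r-pred p-pred)
  leg-hanging (suc d) j {t} {i} d+j≡i q p p-pred e =
    e , next , (λ next≡p → legPred-≢-next j p-pred (sym (cong proj₁ next≡p))) ,
    leg-hanging d (suc j) (trans (+-suc d j) d+j≡i) (proj₂ next) (leg t i j , q) refl (inj₁ (leg-leg t i j)) ,
    nbrs
    where
      next : V
      next = leg t i (suc j) , subst (suc j ≤_) d+j≡i (s≤s (m≤n+m j d)) , proj₂ q
      nbrs : ∀ w → E (leg t i j , q) w → In₂ w p next
      nbrs (r , qr) e′ with leg-nbrs e′
      ... | inj₁ refl = inj₂ (vertex-≡ refl)
      ... | inj₂ r-pred = inj₁ (vertex-≡ (legPred-unique j r-pred p-pred))

  hanging-from-leg : ∀ d {t i j q₀} (q : V) → Hanging d (leg t i j , q₀) q → proj₁ q ≡ leg t i (suc j)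
  hanging-from-leg d {t} {i} {j} {q₀} (r , qr) path with leg-nbrs (hanging-edge d {leg t i j , q₀} {r , qr} path)
  ... | inj₁ r≡ = r≡
  hanging-from-leg d {t} {i} {zero}  {q₀} (r , qr) path | inj₂ r≡ =
    ⊥-elim (hanging-not-crowded d {leg t i 0 , q₀} {r , qr} path (heavy-crowded {r , qr} r≡ (plus2 t)))
  hanging-from-leg d {t} {i} {suc j} {q₀} (r , qr) path | inj₂ refl =
    ⊥-elim (leg-not-hanging-backwards j d {t} {i} {qr} {leg t i (suc j) , q₀} refl path)

  -- The gadget at (u, t) ∈ T is the path t - 0⁰ - 0¹ - … - 0^{2m+4} together
  -- with the flag 0^{2m+2}1, where m = θ u; its only branching vertex is the
  -- branch point 0^{2m+2}.
  branch : Seq2 → ℕ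
  branch u = 2 * θ u + 2

  branch+2 : ∀ u → 2 * θ u + 4 ≡ suc (suc (branch u))
  branch+2 u = trans (+-suc (2 * θ u) 3) (cong suc (+-suc (2 * θ u) 2))

  data Ahead (u : Seq2) (t : Seqω) (k : ℕ) : RawV → Set where
    next : Ahead u t k (tv u t (zeroes (suc k)))
    flag : k ≡ branch u → Ahead u t k (tv u t (zeroes k ∷ʳ true))

  ahead-length : ∀ {u t k r} → Ahead u t k r → length (word r) ≡ suc k
  ahead-length {k = k} next     = length-replicate (suc k)
  ahead-length {k = k} (flag _) = trans (length-∷ʳ (zeroes k) true) (cong suc (length-replicate k))

  tailPred-not-ahead : ∀ {u t} k {r} → TailPred u t k r → ¬ Ahead u t k r
  tailPred-not-ahead zero    refl ()
  tailPred-not-ahead (suc k) refl a = n≢2+n k (trans (sym (length-replicate k)) (ahead-length a))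

  pred≢ahead : ∀ {u t} k {p w : V} → TailPred u t k (proj₁ p) → Ahead u t k (proj₁ w) → w ≢ p
  pred≢ahead k p-pred w-ahead w≡p = tailPred-not-ahead k p-pred (subst (Ahead _ _ k) (cong proj₁ w≡p) w-ahead)

  tail-nbrs : ∀ {u t k q} (w : V) → E (tv u t (zeroes k) , q) w →
              TailPred u t k (proj₁ w) ⊎ Ahead u t k (proj₁ w)
  tail-nbrs {u} {t} {k} (r , qr) e with tv-nbrs e
  ... | inj₁ (b , refl) with allowed-extension (proj₂ qr)
  ...   | inj₁ refl rewrite sym (zeroes-suc k) = inj₂ next
  ...   | inj₂ (refl , k≡) = inj₂ (flag k≡)
  tail-nbrs {k = zero}  (r , qr) e | inj₂ (inj₁ (_ , refl)) = inj₁ refl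
  tail-nbrs {k = zero}  (r , qr) e | inj₂ (inj₂ (y , b , e′ , refl)) = ⊥-elim (∷ʳ≢[] y b (sym e′))
  tail-nbrs {k = suc k} (r , qr) e | inj₂ (inj₂ (y , b , e′ , refl)) =
    inj₁ (cong (tv _ _) (sym (proj₁ (∷ʳ-injective (zeroes k) y (trans (sym (zeroes-suc k)) e′)))))

  flag-nbr : ∀ {u t q} (w : V) → E (tv u t (zeroes (branch u) ∷ʳ true) , q) w →
             proj₁ w ≡ tv u t (zeroes (branch u))
  flag-nbr {u} {t} (r , qr) e with tv-nbrs e
  ... | inj₁ (b , refl) with allowed-prefix (proj₂ qr)
  ...   | _ , flagged≡ = ⊥-elim (zeroes≢flagged _ _ (sym flagged≡))
  flag-nbr (r , qr) e | inj₂ (inj₁ (flagged≡[] , _)) = ⊥-elim (∷ʳ≢[] _ true flagged≡[])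
  flag-nbr (r , qr) e | inj₂ (inj₂ (y , b , e′ , refl)) = cong (tv _ _) (sym (proj₁ (∷ʳ-injective _ y e′)))

  tail-next : ∀ {u t k q q′} → E (tv u t (zeroes k) , q) (tv u t (zeroes (suc k)) , q′)
  tail-next {u} {t} {k} =
    inj₁ (subst (λ x → Adj (tv u t (zeroes k)) (tv u t x)) (sym (zeroes-suc k)) (tv-tv u t (zeroes k) false))

  tail-back : ∀ {u t} k (q : InG # θ T (tv u t (zeroes k))) →
              Σ V λ w → TailPred u t k (proj₁ w) × E (tv u t (zeroes k) , q) w
  tail-back {u} {t} zero    q = (node t , tt) , refl , inj₂ (node-tv u t)
  tail-back {u} {t} (suc k) (m , tok) =
    back , refl , edge-sym {back} {tv u t (zeroes (suc k)) , m , tok} (tail-next {u} {t} {k} {proj₂ back} {m , tok})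
    where back : V
          back = tv u t (zeroes k) , m , zeros k (≤-trans (n≤1+n k) (tailOK-bound tok refl))

  tail-flag : ∀ {u t k q q′} → E (tv u t (zeroes k) , q) (tv u t (zeroes k ∷ʳ true) , q′)
  tail-flag {u} {t} {k} = inj₁ (tv-tv u t (zeroes k) true)

  next≢flag : ∀ {u t k} → tv u t (zeroes (suc k)) ≢ tv u t (zeroes k ∷ʳ true)
  next≢flag {k = k} e
    with () ← proj₂ (∷ʳ-injective (zeroes k) (zeroes k) (trans (sym (zeroes-suc k)) (cong word e)))

  branch-point-not-In₂ : ∀ {u t q} {a b : V} → ¬ (∀ w → E (tv u t (zeroes (branch u)) , q) w → In₂ w a b)
  branch-point-not-In₂ {u} {t} {q@(m , _)} nbrs with tail-back (branch u) q
  ... | back , back-pred , back-edge =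
    three-into-two back≢next next≢flag′ back≢flag
      (nbrs back back-edge) (nbrs next-v (tail-next {q = q} {proj₂ next-v}))
      (nbrs flag-v (tail-flag {q = q} {proj₂ flag-v}))
    where
      next-v flag-v : V
      next-v = tv u t (zeroes (suc (branch u))) , m ,
               zeros _ (≤-trans (n≤1+n _) (≤-reflexive (sym (branch+2 u))))
      flag-v = tv u t (zeroes (branch u) ∷ʳ true) , m , zerosOne
      back≢next : back ≢ next-v
      back≢next = pred≢ahead (branch u) {back} {next-v} back-pred next ∘ sym
      back≢flag : back ≢ flag-v
      back≢flag = pred≢ahead (branch u) {back} {flag-v} back-pred (flag refl) ∘ sym
      next≢flag′ : next-v ≢ flag-v
      next≢flag′ e = next≢flag (cong proj₁ e)

  chain-length : ∀ d k {u t q} {p : V} → TailPred u t k (proj₁ p) → k ≤ branch u →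
                 Chain d p (tv u t (zeroes k) , q) → d + k ≡ branch u
  chain-length zero k {u} {t} {q} {p} p-pred k≤
    (_ , (r₁ , q₁) , (r₂ , q₂) , w₁≢p , w₂≢p , leaf , path₂ , _) with m≤n⇒m<n∨m≡n k≤
  ... | inj₂ k≡ = k≡
  ... | inj₁ k< with tail-nbrs {q = q} (r₁ , q₁) (hanging-edge 0 {v} {r₁ , q₁} leaf)
                   | tail-nbrs {q = q} (r₂ , q₂) (hanging-edge 1 {v} {r₂ , q₂} path₂)
    where
      v : V
      v = tv u t (zeroes k) , q
  ...   | inj₁ w₁-pred | _ = ⊥-elim (w₁≢p (vertex-≡ (tailPred-unique k w₁-pred p-pred)))
  ...   | _ | inj₁ w₂-pred = ⊥-elim (w₂≢p (vertex-≡ (tailPred-unique k w₂-pred p-pred)))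
  ...   | inj₂ (flag k≡) | _ = ⊥-elim (<-irrefl k≡ k<)
  ...   | _ | inj₂ (flag k≡) = ⊥-elim (<-irrefl k≡ k<)
  ...   | inj₂ next | inj₂ next =
    ⊥-elim (leaf-not-long {tv u t (zeroes k) , q} {_ , q₁} leaf 0
             (subst (Hanging 1 (tv u t (zeroes k) , q)) (vertex-≡ refl) path₂))
  chain-length (suc d) k {u} {t} {q} {p} p-pred k≤ (_ , (r , qr) , w≢p , rest , nbrs)
    with m≤n⇒m<n∨m≡n k≤
  ... | inj₂ refl = ⊥-elim (branch-point-not-In₂ {q = q} nbrs)
  ... | inj₁ k< with tail-nbrs {q = q} (r , qr) (chain-edge d {tv u t (zeroes k) , q} {r , qr} rest)
  ...   | inj₁ w-pred = ⊥-elim (w≢p (vertex-≡ (tailPred-unique k w-pred p-pred)))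
  ...   | inj₂ (flag k≡) = ⊥-elim (<-irrefl k≡ k<)
  ...   | inj₂ next = trans (sym (+-suc d k)) (chain-length d (suc k) {q = qr} {tv u t (zeroes k) , q} refl k< rest)

  tail-vertex : ∀ {u t} → mem T u t → ∀ k → k ≤ 2 * θ u + 4 → V
  tail-vertex {u} {t} m k k≤ = tv u t (zeroes k) , m , zeros k k≤

  -- At the branch point of the gadget sits a fork: the flag is a pendant
  -- leaf and 0^{2m+3} - 0^{2m+4} a pendant path.
  branch-fork : ∀ {u t} (m : mem T u t) (K≤ : branch u ≤ 2 * θ u + 4) (p : V) →
                TailPred u t (branch u) (proj₁ p) → E p (tail-vertex m (branch u) K≤) →
                Fork p (tail-vertex m (branch u) K≤)
  branch-fork {u} {t} m K≤ p p-pred e =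
    e , flag-v , next-v ,
    pred≢ahead K {w = flag-v} p-pred (flag refl) , pred≢ahead K {w = next-v} p-pred next ,
    (tail-flag {q = proj₂ v} {proj₂ flag-v} , λ w e′ → vertex-≡ (flag-nbr {q = m , zerosOne} w e′)) ,
    (tail-next {q = proj₂ v} {proj₂ next-v} , end-v ,
      (λ end≡v → n≢2+n K (sym (zeroes-injective (cong (word ∘ proj₁) end≡v)))) ,
      (tail-next {q = proj₂ next-v} {proj₂ end-v} , end-nbrs) , next-nbrs) ,
    v-nbrs
    where
      K : ℕ
      K = branch u
      v : V
      v = tail-vertex m K K≤
      flag-v next-v end-v : V
      flag-v = tv u t (zeroes K ∷ʳ true) , m , zerosOne
      next-v = tail-vertex m (suc K) (≤-trans (n≤1+n _) (≤-reflexive (sym (branch+2 u))))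
      end-v  = tail-vertex m (suc (suc K)) (≤-reflexive (sym (branch+2 u)))
      end-nbrs : ∀ w → E end-v w → w ≡ next-v
      end-nbrs (r , qr) e′ with tail-nbrs {q = proj₂ end-v} (r , qr) e′
      ... | inj₁ refl = vertex-≡ refl
      ... | inj₂ next = ⊥-elim (1+n≰n (subst (suc (suc (suc K)) ≤_) (branch+2 u) (tailOK-bound (proj₂ qr) refl)))
      ... | inj₂ (flag K+2≡K) = ⊥-elim (n≢2+n K (sym K+2≡K))
      next-nbrs : ∀ w → E next-v w → In₂ w v end-v
      next-nbrs (r , qr) e′ with tail-nbrs {q = proj₂ next-v} (r , qr) e′
      ... | inj₁ refl = inj₁ (vertex-≡ refl)
      ... | inj₂ next = inj₂ (vertex-≡ refl)
      ... | inj₂ (flag K+1≡K) = ⊥-elim (1+n≢n K+1≡K)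
      v-nbrs : ∀ w → E v w → In₃ w p flag-v next-v
      v-nbrs (r , qr) e′ with tail-nbrs {q = proj₂ v} (r , qr) e′
      ... | inj₁ r-pred = inj₁ (vertex-≡ (tailPred-unique K r-pred p-pred))
      ... | inj₂ next = inj₂ (inj₂ (vertex-≡ refl))
      ... | inj₂ (flag _) = inj₂ (inj₁ (vertex-≡ refl))

  tail-chain : ∀ d k {u t} (m : mem T u t) (k≤ : k ≤ 2 * θ u + 4) → d + k ≡ branch u → (p : V) →
               TailPred u t k (proj₁ p) → E p (tail-vertex m k k≤) → Chain d p (tail-vertex m k k≤)
  tail-chain zero k m k≤ refl p p-pred e = branch-fork m k≤ p p-pred e
  tail-chain (suc d) k {u} {t} m k≤ d+k≡ p p-pred e =
    e , w , pred≢ahead k {w = w} p-pred next ,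
    tail-chain d (suc k) m k<′ (trans (+-suc d k) d+k≡) v refl (tail-next {q = proj₂ v} {proj₂ w}) ,
    nbrs
    where
      k< : suc k ≤ branch u
      k< = subst (suc k ≤_) d+k≡ (s≤s (m≤n+m k d))
      k<′ : suc k ≤ 2 * θ u + 4
      k<′ = ≤-trans k< (+-monoʳ-≤ (2 * θ u) (s≤s (s≤s z≤n)))
      v w : V
      v = tail-vertex m k k≤
      w = tail-vertex m (suc k) k<′
      nbrs : ∀ w′ → E v w′ → In₂ w′ p w
      nbrs (r , qr) e′ with tail-nbrs {q = proj₂ v} (r , qr) e′
      ... | inj₁ r-pred = inj₁ (vertex-≡ (tailPred-unique k r-pred p-pred))
      ... | inj₂ next = inj₂ (vertex-≡ refl)
      ... | inj₂ (flag k≡) = ⊥-elim (<-irrefl k≡ k<)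

  -- Pendant paths inside a gadget are short: running forward from 0ᵏ they
  -- must avoid the branch point, so they start beyond it ...
  tail-hanging-forward : ∀ d k {u t q} {p : V} → TailPred u t k (proj₁ p) →
                         Hanging d p (tv u t (zeroes k) , q) → d + k ≡ 2 * θ u + 4 × branch u < k
  tail-hanging-forward zero k {u} {t} {q} p-pred (_ , nbrs) with m≤n⇒m<n∨m≡n (tailOK-bound (proj₂ q) refl)
  ... | inj₂ k≡ = k≡ , subst (branch u <_) (sym k≡) (subst (branch u <_) (sym (branch+2 u)) (n≤1+n _))
  ... | inj₁ k< = ⊥-elim (pred≢ahead k {w = next-v} p-pred next (nbrs next-v (tail-next {q = q} {proj₂ next-v})))
    where
      next-v : V
      next-v = tail-vertex (proj₁ q) (suc k) k<
  tail-hanging-forward (suc d) k {u} {t} {q} p-pred (_ , (r , qr) , w≢p , rest , nbrs) with k ≟ branch u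
  ... | yes refl = ⊥-elim (branch-point-not-In₂ {q = q} nbrs)
  ... | no k≢ with tail-nbrs {q = q} (r , qr) (hanging-edge d {tv u t (zeroes k) , q} {r , qr} rest)
  ...   | inj₁ w-pred = ⊥-elim (w≢p (vertex-≡ (tailPred-unique k w-pred p-pred)))
  ...   | inj₂ (flag k≡) = ⊥-elim (k≢ k≡)
  ...   | inj₂ next with tail-hanging-forward d (suc k) {q = qr} {tv u t (zeroes k) , q} refl rest
  ...     | d+k≡ , branch<k = trans (sym (+-suc d k)) d+k≡ , ≤∧≢⇒< (≤-pred branch<k) (k≢ ∘ sym)

  -- ... while running backwards they would reach the crowded vertex t.
  tail-not-hanging-backwards : ∀ d k {u t q} {p : V} → Ahead u t k (proj₁ p) →
                               ¬ Hanging d p (tv u t (zeroes k) , q)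
  tail-not-hanging-backwards zero k {q = q} {p} p-ahead (_ , nbrs) with tail-back k q
  ... | back , back-pred , back-edge =
    pred≢ahead k {back} {p} back-pred p-ahead (sym (nbrs back back-edge))
  tail-not-hanging-backwards (suc d) k {u} {t} {q} {p} p-ahead (e , (r , qr) , w≢p , rest , nbrs)
    with k ≟ branch u
  ... | yes refl = branch-point-not-In₂ {q = q} nbrs
  ... | no k≢ with tail-nbrs {q = q} (r , qr) (hanging-edge d {tv u t (zeroes k) , q} {r , qr} rest)
  ...   | inj₂ (flag k≡) = k≢ k≡
  ...   | inj₂ next with p-ahead
  ...     | flag k≡ = k≢ k≡
  ...     | next = w≢p (vertex-≡ refl)
  tail-not-hanging-backwards (suc d) zero {u} {t} {q} p-ahead (_ , (r , qr) , _ , rest , _) | no _ | inj₁ refl =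
    hanging-not-crowded d {tv u t [] , q} {r , qr} rest (heavy-crowded {r , qr} refl (node t))
  tail-not-hanging-backwards (suc d) (suc k) {u} {t} {q} p-ahead (_ , (r , qr) , _ , rest , _) | no _ | inj₁ refl =
    tail-not-hanging-backwards d k {q = qr} {tv u t (zeroes (suc k)) , q} next rest

  tail-hanging-short : ∀ d {u t x q} {p : V} → Hanging d p (tv u t x , q) → d ≤ 1
  tail-hanging-short d {q = q} path with tailOK-view (proj₂ q)
  tail-hanging-short zero    path | inj₂ refl = z≤n
  tail-hanging-short (suc d) {u} {t} {q = q} {p} (e , w , w≢p , rest , _) | inj₂ refl =
    ⊥-elim (w≢p (vertex-≡ (trans (flag-nbr {q = q} w (hanging-edge d {tv u t _ , q} {w} rest))
                                 (sym (flag-nbr {q = q} p (edge-sym {p} {tv u t _ , q} e))))))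
  tail-hanging-short d {u} {t} {q = q} {p} path | inj₁ (k , refl , _)
    with tail-nbrs {q = q} p (edge-sym {p} {tv u t (zeroes k) , q} (hanging-edge d {p} {tv u t (zeroes k) , q} path))
  ... | inj₂ p-ahead = ⊥-elim (tail-not-hanging-backwards d k p-ahead path)
  ... | inj₁ p-pred with tail-hanging-forward d k p-pred path
  ...   | d+k≡ , branch<k = +-cancelʳ-≤ (suc (branch u)) d 1
          (≤-trans (+-monoʳ-≤ d branch<k) (≤-reflexive (trans d+k≡ (branch+2 u))))

  long-hanging-in-leg : ∀ d {p : V} (q : V) → Hanging (suc (suc d)) p q →
                        Σ Seqω λ t → Σ ℕ λ i → Σ ℕ λ j → proj₁ q ≡ leg t i j
  long-hanging-in-leg d {p} (node t , qq) path =
    ⊥-elim (hanging-not-crowded (suc (suc d)) {p} {node t , qq} path (heavy-crowded {node t , qq} refl (node t)))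
  long-hanging-in-leg d (star t n , _) path = ⊥-elim (star-not-hanging (suc (suc d)) path)
  long-hanging-in-leg d (plus t , _) path = ⊥-elim (plus-not-hanging (suc (suc d)) path)
  long-hanging-in-leg d {p} (plus2 t , qq) path =
    ⊥-elim (hanging-not-crowded (suc (suc d)) {p} {plus2 t , qq} path (heavy-crowded {plus2 t , qq} refl (plus2 t)))
  long-hanging-in-leg d (leg t i j , _) path = t , i , j , refl
  long-hanging-in-leg d (tv u t x , _) path with s≤s () ← tail-hanging-short (suc (suc d)) path

  plus2-leg-hanging : ∀ t i (i≤ : i ≤ # t + 2) → Hanging i (plus2 t , tt) (leg t i 0 , z≤n , i≤)
  plus2-leg-hanging t i i≤ = leg-hanging i 0 (+-identityʳ i) (z≤n , i≤) (plus2 t , tt) refl (inj₁ (plus2-leg t i))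

  plus2-hanging-bound : ∀ d {t q} (w : V) → Hanging d (plus2 t , q) w → d ≤ # t + 2
  plus2-hanging-bound d {t} {q} (r , qr) path with plus2-nbrs (hanging-edge d {plus2 t , q} {r , qr} path)
  ... | inj₁ refl = ⊥-elim (plus-not-hanging d path)
  ... | inj₂ (i , refl) =
    subst (_≤ # t + 2) (trans (sym (leg-hanging-length d refl path)) (+-identityʳ d)) (proj₂ qr)

  reindex : ∀ {n} {p q : V} → Hanging (n + 2) p q → Hanging (suc (suc n)) p q
  reindex {n} {p} {q} = subst (λ d → Hanging d p q) (+-comm n 2)

  hub-at-plus2 : ∀ s → Hub (# s + 2) (plus2 s , tt)
  hub-at-plus2 s =
    ((leg s 0 0 , z≤n , z≤n) , plus2-leg-hanging s 0 z≤n) ,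
    ((leg s (# s + 2) 0 , z≤n , ≤-refl) , plus2-leg-hanging s (# s + 2) ≤-refl) ,
    λ w _ longer → 1+n≰n (plus2-hanging-bound (suc (# s + 2)) w longer)

  -- A hub b for # s + 2 has a long pendant path, so it is s⁺⁺ or on a leg;
  -- on a leg both its pendant leaf and its long path would point forward.
  hub-unique : ∀ s (b : V) → Hub (# s + 2) b → proj₁ b ≡ plus2 s
  hub-unique s (rb , qb) ((q₀ , leaf) , ((r , qr) , path) , no-longer)
    with long-hanging-in-leg (# s) (r , qr) (reindex path)
  ... | t , i , j , refl with leg-nbrs⁻ (hanging-edge (# s + 2) {rb , qb} {r , qr} path)
  ...   | inj₂ (j′ , refl) =
    ⊥-elim (leaf-not-long {rb , qb} {q₀} leaf (suc (# s))
             (subst (Hanging (suc (suc (# s))) (rb , qb)) (vertex-≡ ends≡) (reindex path)))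
    where
      ends≡ : r ≡ proj₁ q₀
      ends≡ = trans (hanging-from-leg (# s + 2) (r , qr) path) (sym (hanging-from-leg 0 q₀ leaf))
  ...   | inj₁ refl = cong plus2 (#-injective (+-cancelʳ-≡ 2 (# t) (# s) (≤-antisym #t≤#s #s≤#t)))
    where
      #s≤#t : # s + 2 ≤ # t + 2
      #s≤#t = plus2-hanging-bound (# s + 2) (r , qr) path
      #t≤#s : # t + 2 ≤ # s + 2
      #t≤#s = ≮⇒≥ λ #s<#t → no-longer _ (inj₁ (plus2-leg t _)) (plus2-leg-hanging t _ #s<#t)

  leg-not-branching : ∀ {t i j q} → ¬ Branching (leg t i j , q)
  leg-not-branching (x , y , z , ex , ey , ez , x≢y , y≢z , x≢z) =
    three-into-two (x≢y ∘ vertex-≡) (y≢z ∘ vertex-≡) (x≢z ∘ vertex-≡)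
                   (leg-nbrs ex) (leg-nbrs ey) (leg-nbrs ez)

  -- s is an anchor for # s + 2, and the only one: the anchor lies at distance
  -- two from the hub s⁺⁺, so it is s or a vertex on a leg.
  anchor-at-node : ∀ s → Anchor (# s + 2) (node s , tt)
  anchor-at-node s =
    (plus s , tt) , (plus2 s , tt) , hub-at-plus2 s , inj₂ (plus-plus2 s) , inj₂ (node-plus s) , (λ ()) ,
    (star s 0 , tt) , (star s 1 , tt) , (star s 2 , tt) ,
    inj₁ (node-star s 0) , inj₁ (node-star s 1) , inj₁ (node-star s 2) , (λ ()) , (λ ()) , (λ ())

  anchor-unique : ∀ s (p : V) → Anchor (# s + 2) p → proj₁ p ≡ node s
  anchor-unique s (rp , qp) ((ra , qa) , (rb , qb) , hub , eba , eap , p≢b , br)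
    with hub-unique s (rb , qb) hub
  ... | refl with plus2-nbrs eba
  ...   | inj₁ refl with plus-nbrs eap
  ...     | inj₁ rp≡ = rp≡
  ...     | inj₂ rp≡ = ⊥-elim (p≢b (vertex-≡ rp≡))
  anchor-unique s (_ , qp) (_ , _ , _ , _ , eap , p≢b , br) | refl | inj₂ (i , refl) with leg-nbrs eap
  ...     | inj₁ refl = ⊥-elim (leg-not-branching {q = qp} br)
  ...     | inj₂ rp≡ = ⊥-elim (p≢b (vertex-≡ rp≡))

  -- The vertex (u, s, ∅) is a marker for # s + 2 and branch u, and the only one:
  -- a chain leaving s cannot start at s* or s⁺, and entering the gadget at
  -- (u′, s) it has length branch u′.
  marker-at-gadget : ∀ s u (m : mem T u s) → Marker (# s + 2) (branch u) (tail-vertex m 0 z≤n)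
  marker-at-gadget s u m =
    (node s , tt) , anchor-at-node s ,
    tail-chain (branch u) 0 m z≤n (+-identityʳ _) (node s , tt) refl (inj₁ (node-tv u s))

  branch-injective : ∀ {u u′} → branch u ≡ branch u′ → u ≡ u′
  branch-injective {u} {u′} e = θ-injective (*-cancelˡ-≡ (θ u) (θ u′) 2 (+-cancelʳ-≡ 2 _ _ e))

  marker-unique : ∀ s u (v : V) → Marker (# s + 2) (branch u) v → proj₁ v ≡ tv u s []
  marker-unique s u (rv , qv) ((rp , qp) , anchor , chain) with anchor-unique s (rp , qp) anchor
  ... | refl with node-nbrs (chain-edge (branch u) {node s , qp} {rv , qv} chain)
  ...   | inj₁ (t , n , refl) = ⊥-elim (heavyNbrs-not-chain (branch u) star-heavyNbrs chain)
  ...   | inj₂ (inj₁ refl) = ⊥-elim (heavyNbrs-not-chain (branch u) plus-heavyNbrs chain)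
  ...   | inj₂ (inj₂ (u′ , refl)) =
    cong (λ x → tv x s [])
         (branch-injective (trans (sym (chain-length (branch u) 0 refl z≤n chain)) (+-identityʳ _)))

iso⇒⊆ : ∀ (# : Seqω → ℕ) (θ : Seq2 → ℕ) →
        (∀ {s t} → # s ≡ # t → s ≡ t) → (∀ {u v} → θ u ≡ θ v → u ≡ v) →
        (S T : NormalTree) → GraphIso (G # θ S) (G # θ T) → ∀ {u s} → mem S u s → mem T u s
iso⇒⊆ # θ #-inj θ-inj S T φ {u} {s} m =
  proj₁ (subst (InG # θ T) image-is-marker (proj₂ (GraphIso.to φ marker)))
  where
    module GS = Analysis # θ #-inj θ-inj S
    module GT = Analysis # θ #-inj θ-inj T
    marker : Graph.V (G # θ S)
    marker = GS.tail-vertex m 0 z≤n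
    image-is-marker : proj₁ (GraphIso.to φ marker) ≡ tv u s []
    image-is-marker = GT.marker-unique s u _
      (transport-marker φ (# s + 2) (GS.branch u) (GS.marker-at-gadget s u m))

lemma3p1 : (hash : Seqω ⤖ ℕ) (θ : Seq2 ⤖ ℕ)
    → (∀ u v → length u < length v → Bijection.to θ u < Bijection.to θ v)
    → (S T : NormalTree) → ¬ SameSet S T → ¬ Iso (G[ hash , θ ] S) (G[ hash , θ ] T)
lemma3p1 hash θ _ S T S≢T iso = S≢T (λ u s → ⊆ φ , ⊆ (iso-sym φ))
  where
    φ : GraphIso (G[ hash , θ ] S) (G[ hash , θ ] T)
    φ = toGraphIso iso
    ⊆ : ∀ {A B} → GraphIso (G[ hash , θ ] A) (G[ hash , θ ] B) → ∀ {u s} → mem A u s → mem B u s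
    ⊆ {A} {B} = iso⇒⊆ (Bijection.to hash) (Bijection.to θ)
                      (Bijection.injective hash) (Bijection.injective θ) A B
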